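{- The greatest common divisor of all Fermat-Wilson quotients $q_p(w_p)$, taken over all non-Wilson primes $p$, is $24$. In particular, $q_p(w_p)$ is never a prime number.
   Context: For a prime $p$, the Wilson quotient is the integer $w_p=\dfrac{(p-1)!+1}{p}$; $p$ is a Wilson prime if $p\mid w_p$, and a non-Wilson prime otherwise. For a prime $p$ and an integer $a$ not divisible by $p$, the Fermat quotient is the integer $q_p(a)=\dfrac{a^{p-1}-1}{p}$. For a non-Wilson prime $p$, the Fermat-Wilson quotient of $p$ is the integer $q_p(w_p)=\dfrac{w_p^{\,p-1}-1}{p}$ (for example $q_2(w_2)=q_3(w_3)=0$ since $w_2=w_3=1$). -}

module Defs where

open import Data.Nat using (ℕ; zero; suc; _+_; _∸_; _^_; _!)
open import Data.Nat.DivMod using (_/_)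

open import Data.Nat.Divisibility using (_∣_)
open import Data.Nat.Primality using (Prime)
open import Data.Product using (_×_)
open import Relation.Nullary using (¬_)

-- Wilson quotient w_p = ((p-1)! + 1) / p  (exact for primes p, by Wilson's theorem).
-- For p = 0 (irrelevant: not prime) we set it to 0.
wilsonQuotient : ℕ → ℕ
wilsonQuotient zero    = 0
wilsonQuotient (suc n) = ((n !) + 1) / suc n

-- Fermat quotient q_p(a) = (a^(p-1) - 1) / p  (exact for p prime, p ∤ a).
fermatQuotient : ℕ → ℕ → ℕ
fermatQuotient zero    a = 0
fermatQuotient (suc n) a = ((a ^ n) ∸ 1) / suc n

NonWilsonPrime : ℕ → Set
NonWilsonPrime p = Prime p × ¬ (p ∣ wilsonQuotient p)

fermatWilsonQuotient : ℕ → ℕ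
fermatWilsonQuotient p = fermatQuotient p (wilsonQuotient p)

module Submission where

-- Neither Fermat's little theorem nor Wilson's theorem is available in the
-- standard library, so both are proved first.
--   * Fermat: p divides the middle binomial coefficients C(p,k), so the
--     binomial theorem gives (a+1)^p ≡ a^p + 1 (mod p), whence a^p ≡ a by
--     induction on a, and a^(p-1) ≡ 1 when p ∤ a.
--   * Wilson: for p = r + 2, x ↦ x^r mod p inverts x modulo p and is a
--     fixed-point-free involution of {2, …, p-2}; pairing every element with
--     its inverse gives 2·3⋯(p-2) ≡ 1, hence (p-1)! ≡ -1 (mod p).
-- Consequently w_p·p = (p-1)! + 1 and q_p(w_p)·p = w_p^(p-1) - 1 exactly. For
-- p ≥ 5, 2 and 3 divide (p-1)! and so cannot divide w_p, a divisor of
-- (p-1)! + 1; as p-1 is even, w_p^(p-1) is the square of a number prime to 6,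
-- hence ≡ 1 (mod 24) by a finite check of residues, and since p is prime to 24,
-- 24 ∣ q_p(w_p). The bound 24 is attained: gcd(q_7(w_7), q_11(w_11)) = 24 by
-- direct computation. Finally, a multiple of 24 is not prime.

open import Defs
open import Data.Nat using (ℕ; zero; suc; _+_; _*_; _∸_; _^_; _≤_; _<_; z≤n; s≤s; NonZero; ≢-nonZero; _!; _≟_; nonTrivial⇒n>1)
open import Data.Nat.Properties
open import Data.Nat.Divisibility
open import Data.Nat.DivMod
open import Data.Nat.Primality using (Prime; euclidsLemma; prime⇒irreducible; prime⇒nonTrivial; prime?; prime[2]; ¬prime[0]; ¬prime[1]; prime⇒¬composite; composite[4])
open import Data.Nat.Combinatorics using (_C_; nCk≡n!/k![n-k]!; k![n∸k]!∣n!; nCn≡1)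
open import Data.Nat.Coprimality using (Coprime; coprime-divisor)
open import Data.Nat.GCD using (gcd; gcd-greatest)
open import Data.Nat.ListAction using (product)
open import Data.Fin using (Fin; zero; suc; toℕ; fromℕ; inject₁; fromℕ<)
open import Data.Fin.Properties using (toℕ-fromℕ; toℕ-inject₁; toℕ<n; toℕ-fromℕ<; all?)
open import Data.Vec.Functional using (foldr; tail)
open import Data.Product using (_×_; _,_; proj₁; proj₂; Σ; ∃)
open import Data.Sum using (_⊎_; inj₁; inj₂; [_,_]′)
open import Data.Empty using (⊥-elim)
open import Function using (_∘_)
open import Data.List using (List; []; _∷_; length)
open import Data.List.Membership.Propositional using (_∈_; _∉_; _─_)
open import Data.List.Relation.Unary.Any using (here; there)
open import Data.List.Relation.Unary.All as All using ()
open import Data.List.Relation.Unary.AllPairs using ([]; _∷_)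
open import Data.List.Relation.Unary.Unique.Propositional using (Unique)
open import Relation.Binary.PropositionalEquality
open import Relation.Nullary using (¬_; _⊎-dec_)
open import Relation.Nullary.Decidable using (toWitness; toWitnessFalse)
open import Algebra.Properties.CommutativeSemigroup *-commutativeSemigroup using (x∙yz≈y∙xz)
import Algebra.Properties.CommutativeSemiring.Binomial as Binomial
open import Algebra.Properties.Semiring.Mult +-*-semiring renaming (_×_ to _×ₛ_) using ()
open import Algebra.Properties.Semiring.Exp +-*-semiring renaming (_^_ to _^ₛ_) using ()

open ≡-Reasoning

%≡⇒∣∸ : ∀ n .{{_ : NonZero n}} a b → a % n ≡ b % n → n ∣ b ∸ a
%≡⇒∣∸ n a b eq = divides (b / n ∸ a / n) (begin
  b ∸ a                                         ≡⟨ cong₂ _∸_ (m≡m%n+[m/n]*n b n) (m≡m%n+[m/n]*n a n) ⟩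
  (b % n + (b / n) * n) ∸ (a % n + (a / n) * n) ≡⟨ cong (λ z → (b % n + (b / n) * n) ∸ (z + (a / n) * n)) eq ⟩
  (b % n + (b / n) * n) ∸ (b % n + (a / n) * n) ≡⟨ [m+n]∸[m+o]≡n∸o (b % n) _ _ ⟩
  (b / n) * n ∸ (a / n) * n                     ≡⟨ *-distribʳ-∸ n (b / n) (a / n) ⟨
  (b / n ∸ a / n) * n                           ∎)

∣∸⇒%≡ : ∀ n .{{_ : NonZero n}} {a b} → a ≤ b → n ∣ b ∸ a → a % n ≡ b % n
∣∸⇒%≡ n {a} {b} a≤b n∣b∸a = begin
  a % n           ≡⟨ %-remove-+ʳ a n∣b∸a ⟨
  (a + (b ∸ a)) % n ≡⟨ cong (_% n) (m+[n∸m]≡n a≤b) ⟩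
  b % n           ∎

*-%-reduceʳ : ∀ n .{{_ : NonZero n}} x y → (x * (y % n)) % n ≡ (x * y) % n
*-%-reduceʳ n x y = begin
  (x * (y % n)) % n            ≡⟨ %-distribˡ-* x (y % n) n ⟩
  (x % n * (y % n % n)) % n     ≡⟨ cong (λ z → (x % n * z) % n) (m%n%n≡m%n y n) ⟩
  (x % n * (y % n)) % n         ≡⟨ %-distribˡ-* x y n ⟨
  (x * y) % n                  ∎

∣∧<⇒≡0 : ∀ {d m} → d ∣ m → m < d → m ≡ 0
∣∧<⇒≡0 {m = zero}  _   _   = refl
∣∧<⇒≡0 {m = suc _} d∣m m<d = ⊥-elim (>⇒∤ m<d d∣m)

prime>1 : ∀ {p} → Prime p → 1 < p
prime>1 {p} pp = nonTrivial⇒n>1 p {{prime⇒nonTrivial pp}}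

prime∤n! : ∀ {p} → Prime p → ∀ n → n < p → ¬ p ∣ n !
prime∤n! pp zero    _    p∣1  = >⇒∤ (prime>1 pp) p∣1
prime∤n! pp (suc n) n<p p∣n! with euclidsLemma (suc n) (n !) pp p∣n!
... | inj₁ p∣n+1 = >⇒∤ n<p p∣n+1
... | inj₂ p∣n!′ = prime∤n! pp n (<-trans (n<1+n n) n<p) p∣n!′

prime∣^⇒∣ : ∀ {p w} → Prime p → ∀ m → p ∣ w ^ m → p ∣ w
prime∣^⇒∣ pp zero    p∣1 = ⊥-elim (>⇒∤ (prime>1 pp) p∣1)
prime∣^⇒∣ {w = w} pp (suc m) p∣w^m+1 with euclidsLemma w (w ^ m) pp p∣w^m+1
... | inj₁ p∣w   = p∣w
... | inj₂ p∣w^m = prime∣^⇒∣ pp m p∣w^m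

prime∤⇒coprime : ∀ {p m} → Prime p → ¬ p ∣ m → Coprime m p
prime∤⇒coprime pp p∤m (i∣m , i∣p) with prime⇒irreducible pp i∣p
... | inj₁ i≡1  = i≡1
... | inj₂ refl = ⊥-elim (p∤m i∣m)

even-or-odd : ∀ n → 2 ∣ n ⊎ 2 ∣ suc n
even-or-odd zero = inj₁ (divides 0 refl)
even-or-odd (suc n) with even-or-odd n
... | inj₁ 2∣n  = inj₂ (∣m∣n⇒∣m+n ∣-refl 2∣n)
... | inj₂ 2∣n+1 = inj₁ 2∣n+1

odd-prime⇒even-pred : ∀ {n} → Prime (suc n) → 2 < suc n → 2 ∣ n
odd-prime⇒even-pred {n} pp 2<p with even-or-odd n
... | inj₁ 2∣n = 2∣n
... | inj₂ 2∣p with prime⇒irreducible pp 2∣p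
...   | inj₁ ()
...   | inj₂ 2≡p = ⊥-elim (<-irrefl 2≡p 2<p)

suc∣suc! : ∀ n → suc n ∣ suc n !
suc∣suc! n = m∣m*n (n !)

-- p divides the binomial coefficients C(p,k) with 0 < k < p, since
-- C(p,k)·k!·(p-k)! = p! while p divides neither k! nor (p-k)!.
prime∣C : ∀ {p k} → Prime p → 0 < k → k < p → p ∣ p C k
prime∣C {zero} pp = ⊥-elim (¬prime[0] pp)
prime∣C {p@(suc m)} {k} pp 0<k k<p with euclidsLemma (p C k) (k ! * (p ∸ k) !) pp p∣C*k!*[p-k]!
  where
  instance _ = k !* (p ∸ k) !≢0
  C*k!*[p-k]!≡p! : (p C k) * (k ! * (p ∸ k) !) ≡ p !
  C*k!*[p-k]!≡p! = trans (cong (_* (k ! * (p ∸ k) !)) (nCk≡n!/k![n-k]! (<⇒≤ k<p)))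
                         (m/n*n≡m (k![n∸k]!∣n! (<⇒≤ k<p)))
  p∣C*k!*[p-k]! : p ∣ (p C k) * (k ! * (p ∸ k) !)
  p∣C*k!*[p-k]! = subst (p ∣_) (sym C*k!*[p-k]!≡p!) (suc∣suc! m)
... | inj₁ p∣C = p∣C
... | inj₂ p∣k!*[p-k]! with euclidsLemma (k !) ((p ∸ k) !) pp p∣k!*[p-k]!
...   | inj₁ p∣k!     = ⊥-elim (prime∤n! pp k k<p p∣k!)
...   | inj₂ p∣[p-k]! = ⊥-elim (prime∤n! pp (p ∸ k) (∸-monoʳ-< 0<k (<⇒≤ k<p)) p∣[p-k]!)

-- Fermat's little theorem

-- The library's binomial theorem is stated for an arbitrary commutative
-- semiring, whose multiples and powers agree with those of ℕ.
module ℕ-Binomial = Binomial +-*-commutativeSemiring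

×ₛ≡* : ∀ n z → n ×ₛ z ≡ n * z
×ₛ≡* zero    z = refl
×ₛ≡* (suc n) z = cong (z +_) (×ₛ≡* n z)

^ₛ≡^ : ∀ x n → x ^ₛ n ≡ x ^ n
^ₛ≡^ x zero    = refl
^ₛ≡^ x (suc n) = cong (x *_) (^ₛ≡^ x n)

∑ : ∀ {n} → (Fin n → ℕ) → ℕ
∑ = foldr _+_ 0

∑-divisible-but-last : ∀ d n (t : Fin (suc n) → ℕ) → (∀ i → d ∣ t (inject₁ i)) →
                       ∃ λ k → ∑ t ≡ k * d + t (fromℕ n)
∑-divisible-but-last d zero    t _   = 0 , +-identityʳ (t zero)
∑-divisible-but-last d (suc n) t d∣t with ∑-divisible-but-last d n (tail t) (λ i → d∣t (suc i)) | d∣t zero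
... | k , ∑tail≡ | divides j t₀≡ = j + k , (begin
  t zero + ∑ (tail t)                 ≡⟨ cong₂ _+_ t₀≡ ∑tail≡ ⟩
  j * d + (k * d + t (fromℕ (suc n))) ≡⟨ +-assoc (j * d) (k * d) _ ⟨
  j * d + k * d + t (fromℕ (suc n))   ≡⟨ cong (_+ t (fromℕ (suc n))) (*-distribʳ-+ d j k) ⟨
  (j + k) * d + t (fromℕ (suc n))     ∎)

middle-terms-divisible : ∀ {m} → Prime (suc m) → ∀ a (i : Fin m) →
                         suc m ∣ ℕ-Binomial.binomialTerm a 1 (suc m) (suc (inject₁ i))
middle-terms-divisible {m} pp a i = subst (suc m ∣_) (sym (×ₛ≡* (suc m C suc (toℕ (inject₁ i))) _))
  (∣m⇒∣m*n _ (prime∣C pp (s≤s z≤n) (s≤s (subst (_< m) (sym (toℕ-inject₁ i)) (toℕ<n i)))))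

-- "Freshman's dream": (a + 1)^p ≡ a^p + 1 modulo a prime p, because the
-- binomial terms other than the first and the last are multiples of p.
freshmans-dream : ∀ p → Prime p → ∀ a → ∃ λ k → (a + 1) ^ p ≡ 1 + (k * p + a ^ p)
freshmans-dream zero pp = ⊥-elim (¬prime[0] pp)
freshmans-dream p@(suc m) pp a with ∑-divisible-but-last p m (tail term) (middle-terms-divisible pp a)
  where term = ℕ-Binomial.binomialTerm a 1 p
... | k , ∑middle≡ = k , (begin
  (a + 1) ^ p                ≡⟨ ^ₛ≡^ (a + 1) p ⟨
  (a + 1) ^ₛ p               ≡⟨ ℕ-Binomial.theorem p a 1 ⟩
  term zero + ∑ (tail term)  ≡⟨ cong₂ _+_ first (trans ∑middle≡ (cong (k * p +_) last)) ⟩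
  1 + (k * p + a ^ p)        ∎)
  where
  term = ℕ-Binomial.binomialTerm a 1 p
  first : term zero ≡ 1
  first = begin
    1 ×ₛ (1 * 1 ^ₛ p) ≡⟨ ×ₛ≡* 1 _ ⟩
    1 * (1 * 1 ^ₛ p)  ≡⟨ trans (*-identityˡ _) (*-identityˡ _) ⟩
    1 ^ₛ p            ≡⟨ ^ₛ≡^ 1 p ⟩
    1 ^ p             ≡⟨ ^-zeroˡ p ⟩
    1                 ∎
  last : term (fromℕ p) ≡ a ^ p
  last rewrite toℕ-fromℕ m = begin
    (p C p) ×ₛ (a ^ₛ p * 1 ^ₛ (m ∸ m)) ≡⟨ ×ₛ≡* (p C p) _ ⟩
    (p C p) * (a ^ₛ p * 1 ^ₛ (m ∸ m))  ≡⟨ cong₂ _*_ (nCn≡1 p) (cong₂ _*_ (^ₛ≡^ a p) (cong (1 ^ₛ_) (n∸n≡0 m))) ⟩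
    1 * (a ^ p * 1)                   ≡⟨ trans (*-identityˡ _) (*-identityʳ _) ⟩
    a ^ p                             ∎

fermat-^p : ∀ p .{{_ : NonZero p}} → Prime p → ∀ a → (a ^ p) % p ≡ a % p
fermat-^p (suc m) pp zero    = refl
fermat-^p p       pp (suc a) with freshmans-dream p pp a
... | k , dream = begin
  suc a ^ p % p                    ≡⟨ cong (λ z → z ^ p % p) (+-comm 1 a) ⟩
  (a + 1) ^ p % p                  ≡⟨ cong (_% p) (trans dream (cong (1 +_) (+-comm (k * p) (a ^ p)))) ⟩
  (1 + (a ^ p + k * p)) % p        ≡⟨ cong (_% p) (+-assoc 1 (a ^ p) (k * p)) ⟨
  (1 + a ^ p + k * p) % p          ≡⟨ [m+kn]%n≡m%n (1 + a ^ p) k p ⟩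
  (1 + a ^ p) % p                  ≡⟨ %-distribˡ-+ 1 (a ^ p) p ⟩
  (1 % p + a ^ p % p) % p          ≡⟨ cong (λ z → (1 % p + z) % p) (fermat-^p p pp a) ⟩
  (1 % p + a % p) % p              ≡⟨ %-distribˡ-+ 1 a p ⟨
  suc a % p                        ∎

-- Fermat's little theorem: p ∣ a^(p-1) - 1 when p ∤ a, cancelling a from p ∣ a^p - a.
fermat : ∀ p .{{_ : NonZero p}} → Prime p → ∀ a → ¬ p ∣ a → p ∣ a ^ (p ∸ 1) ∸ 1
fermat (suc m) pp a p∤a with euclidsLemma a (a ^ m ∸ 1) pp p∣a*[a^m-1]
  where
  p∣a*[a^m-1] : suc m ∣ a * (a ^ m ∸ 1)
  p∣a*[a^m-1] = subst (suc m ∣_)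
    (trans (cong (a * a ^ m ∸_) (sym (*-identityʳ a))) (sym (*-distribˡ-∸ a (a ^ m) 1)))
    (%≡⇒∣∸ (suc m) a (a ^ suc m) (sym (fermat-^p (suc m) pp a)))
... | inj₁ p∣a         = ⊥-elim (p∤a p∣a)
... | inj₂ p∣a^m∸1     = p∣a^m∸1

-- Products over lists paired off by an involution

module _ {y : ℕ} where

  product-─ : ∀ {xs} (m : y ∈ xs) → product xs ≡ y * product (xs ─ m)
  product-─ (here refl) = refl
  product-─ {x ∷ xs} (there m) = begin
    x * product xs               ≡⟨ cong (x *_) (product-─ m) ⟩
    x * (y * product (xs ─ m))   ≡⟨ x∙yz≈y∙xz x y _ ⟩
    y * (x * product (xs ─ m))   ∎

  length-─ : ∀ {xs} (m : y ∈ xs) → length xs ≡ suc (length (xs ─ m))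
  length-─ (here _)  = refl
  length-─ (there m) = cong suc (length-─ m)

  ∈-─⁻ : ∀ {xs z} (m : y ∈ xs) → z ∈ xs ─ m → z ∈ xs
  ∈-─⁻ (here _)  z∈        = there z∈
  ∈-─⁻ (there m) (here e)  = here e
  ∈-─⁻ (there m) (there z∈) = there (∈-─⁻ m z∈)

  ∈-─⁺ : ∀ {xs z} (m : y ∈ xs) → z ∈ xs → z ≡ y ⊎ z ∈ xs ─ m
  ∈-─⁺ (here refl) (here e)   = inj₁ e
  ∈-─⁺ (here _)    (there z∈) = inj₂ z∈
  ∈-─⁺ (there m)   (here e)   = inj₂ (here e)
  ∈-─⁺ (there m)   (there z∈) with ∈-─⁺ m z∈
  ... | inj₁ z≡y   = inj₁ z≡y
  ... | inj₂ z∈xs─m = inj₂ (there z∈xs─m)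

  unique-─ : ∀ {xs} (m : y ∈ xs) → Unique xs → Unique (xs ─ m)
  unique-─ (here _)  (_ ∷ u)     = u
  unique-─ (there m) (x∉ ∷ u) = All.tabulate (λ z∈ → All.lookup x∉ (∈-─⁻ m z∈)) ∷ unique-─ m u

  ∉-─ : ∀ {xs} (m : y ∈ xs) → Unique xs → y ∉ xs ─ m
  ∉-─ (here refl) (y∉ ∷ _) y∈      = All.lookup y∉ y∈ refl
  ∉-─ (there m)   (x∉ ∷ u) (here e)  = All.lookup x∉ m (sym e)
  ∉-─ (there m)   (x∉ ∷ u) (there y∈) = ∉-─ m u y∈

record FreeInvolution (ι : ℕ → ℕ) (L : List ℕ) : Set where
  field
    unique      : Unique L
    closed      : ∀ {x} → x ∈ L → ι x ∈ L
    involutive  : ∀ {x} → x ∈ L → ι (ι x) ≡ x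
    no-fixpoint : ∀ {x} → x ∈ L → ι x ≢ x

module _ {ι : ℕ → ℕ} where

  remove-pair : ∀ {x T} → FreeInvolution ι (x ∷ T) →
                Σ (ι x ∈ T) λ ιx∈T → FreeInvolution ι (T ─ ιx∈T)
  remove-pair {x} {T} I with FreeInvolution.closed I (here refl)
  ... | here ιx≡x = ⊥-elim (FreeInvolution.no-fixpoint I (here refl) ιx≡x)
  ... | there ιx∈T = ιx∈T , record
    { unique      = unique-─ ιx∈T T-unique
    ; closed      = closed′
    ; involutive  = λ z∈ → involutive (inT z∈)
    ; no-fixpoint = λ z∈ → no-fixpoint (inT z∈)
    }
    where
    open FreeInvolution I
    T-unique : Unique T
    T-unique with _ ∷ u ← unique = u
    x∉T : x ∉ T
    x∉T x∈T with x∉ ∷ _ ← unique = All.lookup x∉ x∈T refl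
    inT : ∀ {z} → z ∈ T ─ ιx∈T → z ∈ x ∷ T
    inT z∈ = there (∈-─⁻ ιx∈T z∈)
    -- ι z can be neither x (then z = ι x) nor ι x (then z = x).
    closed′ : ∀ {z} → z ∈ T ─ ιx∈T → ι z ∈ T ─ ιx∈T
    closed′ {z} z∈ with closed (inT z∈)
    ... | here ιz≡x = ⊥-elim (∉-─ ιx∈T T-unique
                        (subst (_∈ T ─ ιx∈T) (trans (sym (involutive (inT z∈))) (cong ι ιz≡x)) z∈))
    ... | there ιz∈T with ∈-─⁺ ιx∈T ιz∈T
    ...   | inj₂ ιz∈T─ = ιz∈T─
    ...   | inj₁ ιz≡ιx = ⊥-elim (x∉T (subst (_∈ T)
                          (trans (sym (involutive (inT z∈))) (trans (cong ι ιz≡ιx) (involutive (here refl))))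
                          (∈-─⁻ ιx∈T z∈)))

  -- If ι is a free involution of L with x · ι x ≡ 1 (mod n) for x ∈ L, then
  -- ∏ L ≡ 1 (mod n); by induction on a bound for the length of L, removing
  -- one pair {x, ι x} at a time.
  product-paired : ∀ n .{{_ : NonZero n}} bound (L : List ℕ) → length L ≤ bound →
                   FreeInvolution ι L → (∀ {x} → x ∈ L → (x * ι x) % n ≡ 1 % n) →
                   product L % n ≡ 1 % n
  product-paired n _           []      _ _ _ = refl
  product-paired n zero        (_ ∷ _) () _ _
  product-paired n (suc bound) (x ∷ T) (s≤s |T|≤bound) I inverse
    with ιx∈T , I′ ← remove-pair I = begin
    (x * product T) % n            ≡⟨ cong (λ z → (x * z) % n) (product-─ ιx∈T) ⟩
    (x * (ι x * product T′)) % n   ≡⟨ cong (_% n) (*-assoc x (ι x) _) ⟨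
    (x * ι x * product T′) % n     ≡⟨ %-distribˡ-* (x * ι x) (product T′) n ⟩
    ((x * ι x) % n * (product T′ % n)) % n
      ≡⟨ cong₂ (λ a b → (a * b) % n) (inverse (here refl)) ih ⟩
    (1 % n * (1 % n)) % n          ≡⟨ %-distribˡ-* 1 1 n ⟨
    1 % n                          ∎
    where
    T′ = T ─ ιx∈T
    |T′|≤bound : length T′ ≤ bound
    |T′|≤bound = ≤-trans (n≤1+n _) (≤-trans (≤-reflexive (sym (length-─ ιx∈T))) |T|≤bound)
    ih : product T′ % n ≡ 1 % n
    ih = product-paired n bound T′ |T′|≤bound I′ (λ z∈ → inverse (there (∈-─⁻ ιx∈T z∈)))

-- Wilson's theorem

twoTo : ℕ → List ℕ
twoTo 0             = []
twoTo 1             = []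
twoTo (suc (suc n)) = suc (suc n) ∷ twoTo (suc n)

product-twoTo : ∀ n → product (twoTo n) ≡ n !
product-twoTo 0             = refl
product-twoTo 1             = refl
product-twoTo (suc (suc n)) = cong (suc (suc n) *_) (product-twoTo (suc n))

∈-twoTo⁻ : ∀ {n x} → x ∈ twoTo n → 2 ≤ x × x ≤ n
∈-twoTo⁻ {suc (suc n)} (here refl) = s≤s (s≤s z≤n) , ≤-refl
∈-twoTo⁻ {suc (suc n)} (there x∈)  with 2≤x , x≤n ← ∈-twoTo⁻ {suc n} x∈ = 2≤x , m≤n⇒m≤1+n x≤n

∈-twoTo⁺ : ∀ {n x} → 2 ≤ x → x ≤ n → x ∈ twoTo n
∈-twoTo⁺ {zero}        (s≤s (s≤s z≤n)) ()
∈-twoTo⁺ {suc zero}    (s≤s (s≤s z≤n)) (s≤s ())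
∈-twoTo⁺ {suc (suc n)} 2≤x x≤n =
  [ (λ x<n → there (∈-twoTo⁺ {suc n} 2≤x (≤-pred x<n))) , here ]′ (m≤n⇒m<n∨m≡n x≤n)

twoTo-unique : ∀ n → Unique (twoTo n)
twoTo-unique 0             = []
twoTo-unique 1             = []
twoTo-unique (suc (suc n)) =
  All.tabulate (λ x∈ n≡x → <-irrefl (sym n≡x) (s≤s (proj₂ (∈-twoTo⁻ x∈)))) ∷ twoTo-unique (suc n)

module Wilson (r : ℕ) (pp : Prime (2 + r)) where

  p : ℕ
  p = 2 + r

  Inner : ℕ → Set
  Inner x = 2 ≤ x × x ≤ r

  Inner⇒<p : ∀ {x} → Inner x → x < p
  Inner⇒<p (_ , x≤r) = s≤s (m≤n⇒m≤1+n x≤r)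

  Inner⇒p∤ : ∀ {x} → Inner x → ¬ p ∣ x
  Inner⇒p∤ {suc _} x-inner = >⇒∤ (Inner⇒<p x-inner)

  inv : ℕ → ℕ
  inv x = (x ^ r) % p

  inv<p : ∀ x → inv x < p
  inv<p x = m%n<n (x ^ r) p

  -- x · inv x ≡ x^(p-1) ≡ 1 by Fermat's little theorem.
  inv-inverse : ∀ {x} → ¬ p ∣ x → (x * inv x) % p ≡ 1
  inv-inverse {x} p∤x = begin
    (x * inv x) % p   ≡⟨ *-%-reduceʳ p x (x ^ r) ⟩
    (x ^ suc r) % p   ≡⟨ ∣∸⇒%≡ p (m^n>0 x {{≢-nonZero x≢0}} (suc r)) (fermat p pp x p∤x) ⟨
    1                 ∎
    where
    x≢0 : x ≢ 0
    x≢0 refl = p∤x (divides 0 refl)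

  inverse⇒p∤ : ∀ {z y} → (z * y) % p ≡ 1 → ¬ p ∣ y
  inverse⇒p∤ {z} {y} zy≡1 p∣y with trans (sym (n∣m⇒m%n≡0 (z * y) p (∣n⇒∣m*n z p∣y))) zy≡1
  ... | ()

  ∣∸-cancelʳ : ∀ {x z y} → z < p → ¬ p ∣ y → p ∣ z * y ∸ x * y → z ≤ x
  ∣∸-cancelʳ {x} {z} {y} z<p p∤y p∣zy∸xy
    with euclidsLemma (z ∸ x) y pp (subst (p ∣_) (sym (*-distribʳ-∸ y z x)) p∣zy∸xy)
  ... | inj₁ p∣z∸x = m∸n≡0⇒m≤n (∣∧<⇒≡0 p∣z∸x (≤-<-trans (m∸n≤m z x) z<p))
  ... | inj₂ p∣y   = ⊥-elim (p∤y p∣y)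

  cancelʳ : ∀ {x z y} → x < p → z < p → ¬ p ∣ y → (x * y) % p ≡ (z * y) % p → x ≡ z
  cancelʳ {x} {z} {y} x<p z<p p∤y eq with ≤-total x z
  ... | inj₁ x≤z = ≤-antisym x≤z (∣∸-cancelʳ z<p p∤y (%≡⇒∣∸ p (x * y) (z * y) eq))
  ... | inj₂ z≤x = sym (≤-antisym z≤x (∣∸-cancelʳ x<p p∤y (%≡⇒∣∸ p (z * y) (x * y) (sym eq))))

  -- (p - 1)² ≡ 1, as (r + 1)² = 1 + r·p.
  [p-1]²≡1 : (suc r * suc r) % p ≡ 1
  [p-1]²≡1 = begin
    (suc r * suc r) % p ≡⟨ cong (λ z → suc z % p) (*-suc r (suc r)) ⟨
    (1 + r * p) % p     ≡⟨ [m+kn]%n≡m%n 1 r p ⟩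
    1                   ∎

  -- The only square roots of 1 modulo p are ±1: for x = y + 1, p ∣ x² - 1 = y·(y + 2).
  inner-not-self-inverse : ∀ {x} → Inner x → (x * x) % p ≢ 1
  inner-not-self-inverse {1}             (s≤s () , _)
  inner-not-self-inverse {suc y@(suc _)} (_ , x≤r) x²≡1
    with euclidsLemma y (suc (suc y)) pp (subst (p ∣_) (sym (*-suc y (suc y))) (%≡⇒∣∸ p 1 (suc y * suc y) (sym x²≡1)))
  ... | inj₁ p∣y   = >⇒∤ (m≤n⇒m≤1+n (m≤n⇒m≤1+n x≤r)) p∣y
  ... | inj₂ p∣y+2 = >⇒∤ (s≤s (s≤s x≤r)) p∣y+2

  -- Inversion maps the inner residues to themselves: inv x is neither 0
  -- (x · 0 ≢ 1), nor 1 (x · 1 ≡ x ≢ 1), nor p - 1 (as (p - 1)² ≡ 1 and x ≢ p - 1).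
  inv-inner : ∀ {x} → Inner x → Inner (inv x)
  inv-inner {x} x-inner@(2≤x , x≤r) = two≤ (inv x) inv≢0 inv≢1 , ≤-pred (≤∧≢⇒< (≤-pred (inv<p x)) inv≢p-1)
    where
    inverse : (x * inv x) % p ≡ 1
    inverse = inv-inverse (Inner⇒p∤ x-inner)
    inv≢0 : inv x ≢ 0
    inv≢0 ι≡0 = 0≢1+n (begin
      0               ≡⟨ cong (_% p) (*-zeroʳ x) ⟨
      (x * 0) % p     ≡⟨ cong (λ z → (x * z) % p) ι≡0 ⟨
      (x * inv x) % p ≡⟨ inverse ⟩
      1               ∎)
    inv≢1 : inv x ≢ 1
    inv≢1 ι≡1 = <-irrefl (sym x≡1) 2≤x
      where
      x≡1 : x ≡ 1
      x≡1 = begin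
        x               ≡⟨ m<n⇒m%n≡m (Inner⇒<p x-inner) ⟨
        x % p           ≡⟨ cong (_% p) (*-identityʳ x) ⟨
        (x * 1) % p     ≡⟨ cong (λ z → (x * z) % p) ι≡1 ⟨
        (x * inv x) % p ≡⟨ inverse ⟩
        1               ∎
    inv≢p-1 : inv x ≢ suc r
    inv≢p-1 ι≡p-1 = <-irrefl x≡p-1 (s≤s x≤r)
      where
      x≡p-1 : x ≡ suc r
      x≡p-1 = cancelʳ (Inner⇒<p x-inner) (n<1+n (suc r)) (>⇒∤ (n<1+n (suc r)))
                (trans (trans (cong (λ z → (x * z) % p) (sym ι≡p-1)) inverse) (sym [p-1]²≡1))
    two≤ : ∀ z → z ≢ 0 → z ≢ 1 → 2 ≤ z
    two≤ zero          z≢0 _   = ⊥-elim (z≢0 refl)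
    two≤ (suc zero)    _   z≢1 = ⊥-elim (z≢1 refl)
    two≤ (suc (suc _)) _   _   = s≤s (s≤s z≤n)

  -- Inversion is an involution: both inv (inv x) and x are inverse to inv x.
  inv-involutive : ∀ {x} → x < p → ¬ p ∣ x → inv (inv x) ≡ x
  inv-involutive {x} x<p p∤x = cancelʳ {inv (inv x)} {x} {inv x} (inv<p (inv x)) x<p p∤inv (begin
    (inv (inv x) * inv x) % p ≡⟨ cong (_% p) (*-comm (inv (inv x)) (inv x)) ⟩
    (inv x * inv (inv x)) % p ≡⟨ inv-inverse p∤inv ⟩
    1                         ≡⟨ inv-inverse p∤x ⟨
    (x * inv x) % p           ∎)
    where
    p∤inv : ¬ p ∣ inv x
    p∤inv = inverse⇒p∤ {x} (inv-inverse p∤x)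

  inv-pairs-twoTo : FreeInvolution inv (twoTo r)
  inv-pairs-twoTo = record
    { unique      = twoTo-unique r
    ; closed      = λ x∈ → ∈-twoTo⁺ (proj₁ (inv-inner (∈-twoTo⁻ x∈))) (proj₂ (inv-inner (∈-twoTo⁻ x∈)))
    ; involutive  = λ x∈ → inv-involutive (Inner⇒<p (∈-twoTo⁻ x∈)) (Inner⇒p∤ (∈-twoTo⁻ x∈))
    ; no-fixpoint = λ {x} x∈ ιx≡x → inner-not-self-inverse (∈-twoTo⁻ x∈)
                      (trans (cong (λ z → (x * z) % p) (sym ιx≡x)) (inv-inverse (Inner⇒p∤ (∈-twoTo⁻ x∈))))
    }

  -- 2·3⋯(p-2) ≡ 1 (mod p), pairing every factor with its inverse.
  r!≡1 : r ! % p ≡ 1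
  r!≡1 = begin
    r ! % p                ≡⟨ cong (_% p) (product-twoTo r) ⟨
    product (twoTo r) % p  ≡⟨ product-paired p (length (twoTo r)) (twoTo r) ≤-refl inv-pairs-twoTo
                                (λ x∈ → inv-inverse (Inner⇒p∤ (∈-twoTo⁻ x∈))) ⟩
    1                      ∎

  -- Wilson's theorem: (p - 1)! = (p - 1)·(p - 2)! ≡ p - 1 ≡ -1 (mod p).
  wilson : p ∣ suc r ! + 1
  wilson = m%n≡0⇒n∣m _ p (begin
    (suc r * r ! + 1) % p               ≡⟨ %-distribˡ-+ (suc r * r !) 1 p ⟩
    ((suc r * r !) % p + 1) % p         ≡⟨ cong (λ z → (z + 1) % p) (*-%-reduceʳ p (suc r) (r !)) ⟨
    ((suc r * (r ! % p)) % p + 1) % p   ≡⟨ cong (λ z → ((suc r * z) % p + 1) % p) r!≡1 ⟩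
    ((suc r * 1) % p + 1) % p           ≡⟨ %-distribˡ-+ (suc r * 1) 1 p ⟨
    (suc r * 1 + 1) % p                 ≡⟨ cong (λ z → (z + 1) % p) (*-identityʳ (suc r)) ⟩
    (suc r + 1) % p                     ≡⟨ cong (_% p) (+-comm (suc r) 1) ⟩
    p % p                               ≡⟨ n%n≡0 p ⟩
    0                                   ∎)

wilsonQuotient-exact : ∀ {p} → Prime p → wilsonQuotient p * p ≡ (p ∸ 1) ! + 1
wilsonQuotient-exact {0}           pp = ⊥-elim (¬prime[0] pp)
wilsonQuotient-exact {1}           pp = ⊥-elim (¬prime[1] pp)
wilsonQuotient-exact {suc (suc r)} pp = m/n*n≡m (Wilson.wilson r pp)

fermatQuotient-exact : ∀ {p a} → Prime p → ¬ p ∣ a → fermatQuotient p a * p ≡ a ^ (p ∸ 1) ∸ 1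
fermatQuotient-exact {0}     pp = ⊥-elim (¬prime[0] pp)
fermatQuotient-exact {suc n} {a} pp p∤a = m/n*n≡m (fermat (suc n) pp a p∤a)

-- Divisibility by 24

-- A number d with 2 ≤ d ≤ n divides n!, hence not n! + 1.
∤n!+1 : ∀ {d n} → 2 ≤ d → d ≤ n → ¬ d ∣ n ! + 1
∤n!+1 {suc d} 2≤d d≤n d∣n!+1 = >⇒∤ 2≤d (∣m+n∣m⇒∣n d∣n!+1 (∣-trans (suc∣suc! d) (m≤n⇒m!∣n! d≤n)))

units-mod-24 : ∀ s → s < 24 → 2 ∣ s ⊎ 3 ∣ s ⊎ (s * s) % 24 ≡ 1
units-mod-24 s s<24 = subst Claim (toℕ-fromℕ< s<24) (check (fromℕ< s<24))
  where
  Claim : ℕ → Set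
  Claim t = 2 ∣ t ⊎ 3 ∣ t ⊎ (t * t) % 24 ≡ 1
  check : ∀ (t : Fin 24) → Claim (toℕ t)
  check = toWitness {a? = all? (λ t → 2 ∣? toℕ t ⊎-dec 3 ∣? toℕ t ⊎-dec ((toℕ t * toℕ t) % 24 ≟ 1))} _

-- So 24 ∣ u² - 1 for every u prime to 6 (as 2, 3 ∣ 24, also u % 24 is prime to 6).
24∣square∸1 : ∀ u → ¬ 2 ∣ u → ¬ 3 ∣ u → 24 ∣ u * u ∸ 1
24∣square∸1 u 2∤u 3∤u = [ ⊥-elim ∘ 2∤s , [ ⊥-elim ∘ 3∤s , 24∣u²∸1 ]′ ]′ (units-mod-24 (u % 24) (m%n<n u 24))
  where
  2∤s : ¬ 2 ∣ u % 24
  2∤s 2∣s = 2∤u (∣n∣m%n⇒∣m (divides 12 refl) 2∣s)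
  3∤s : ¬ 3 ∣ u % 24
  3∤s 3∣s = 3∤u (∣n∣m%n⇒∣m (divides 8 refl) 3∣s)
  24∣u²∸1 : (u % 24 * (u % 24)) % 24 ≡ 1 → 24 ∣ u * u ∸ 1
  24∣u²∸1 s²≡1 = %≡⇒∣∸ 24 1 (u * u) (sym (trans (%-distribˡ-* u u 24) s²≡1))

prime[3] : Prime 3
prime[3] = toWitness {a? = prime? 3} _

-- Hence 24 ∣ w^n - 1 for even n and w prime to 6: w^n is the square of w^(n/2).
24∣even-power∸1 : ∀ w n → 2 ∣ n → ¬ 2 ∣ w → ¬ 3 ∣ w → 24 ∣ w ^ n ∸ 1
24∣even-power∸1 w n (divides k n≡k*2) 2∤w 3∤w =
  subst (λ z → 24 ∣ z ∸ 1) u²≡w^n (24∣square∸1 u (2∤w ∘ prime∣^⇒∣ prime[2] k) (3∤w ∘ prime∣^⇒∣ prime[3] k))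
  where
  u = w ^ k
  u²≡w^n : u * u ≡ w ^ n
  u²≡w^n = begin
    u * u        ≡⟨ cong (u *_) (*-identityʳ u) ⟨
    u ^ 2        ≡⟨ ^-*-assoc w k 2 ⟩
    w ^ (k * 2)  ≡⟨ cong (w ^_) n≡k*2 ⟨
    w ^ n        ∎

-- A multiple of 24 is not prime: being even, it would have to be 2.
24∣⇒¬prime : ∀ {n} → 24 ∣ n → ¬ Prime n
24∣⇒¬prime 24∣n n-prime with prime⇒irreducible n-prime (∣-trans {2} (divides 12 refl) 24∣n)
... | inj₁ ()
... | inj₂ refl = >⇒∤ (s≤s (s≤s (s≤s z≤n))) 24∣n

24∣q-for-p≥5 : ∀ r → 3 ≤ r → NonWilsonPrime (2 + r) → 24 ∣ fermatWilsonQuotient (2 + r)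
24∣q-for-p≥5 r 3≤r (pp , p∤w) =
  coprime-divisor (prime∤⇒coprime pp p∤24) (subst (24 ∣_) w^[p-1]∸1≡p*q 24∣w^[p-1]∸1)
  where
  p = 2 + r
  w = wilsonQuotient p
  q = fermatWilsonQuotient p
  3<p : 3 < p
  3<p = ≤-trans (s≤s 3≤r) (n≤1+n _)
  3≤p-1 : 3 ≤ suc r
  3≤p-1 = m≤n⇒m≤1+n 3≤r
  p∤24 : ¬ p ∣ 24
  p∤24 p∣24 with euclidsLemma (2 ^ 3) 3 pp p∣24
  ... | inj₁ p∣2³ = >⇒∤ (<-trans (n<1+n 2) 3<p) (prime∣^⇒∣ pp 3 p∣2³)
  ... | inj₂ p∣3  = >⇒∤ 3<p p∣3
  -- 2 and 3 divide (p - 1)!, so they cannot divide w, as w·p = (p - 1)! + 1.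
  w-coprime : ∀ {d} → 2 ≤ d → d ≤ suc r → ¬ d ∣ w
  w-coprime {d} 2≤d d≤p-1 d∣w = ∤n!+1 2≤d d≤p-1 (subst (d ∣_) (wilsonQuotient-exact pp) (∣m⇒∣m*n p d∣w))
  w^[p-1]∸1≡p*q : w ^ suc r ∸ 1 ≡ p * q
  w^[p-1]∸1≡p*q = trans (sym (fermatQuotient-exact pp p∤w)) (*-comm q p)
  -- p - 1 is even and w is prime to 6.
  24∣w^[p-1]∸1 : 24 ∣ w ^ suc r ∸ 1
  24∣w^[p-1]∸1 = 24∣even-power∸1 w (suc r) (odd-prime⇒even-pred pp (<-trans (n<1+n 2) 3<p))
                   (w-coprime ≤-refl (≤-trans (n≤1+n 2) 3≤p-1)) (w-coprime (n≤1+n 2) 3≤p-1)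

-- (i) 24 divides every Fermat–Wilson quotient (q_2(w_2) = q_3(w_3) = 0).
24∣fermatWilsonQuotient : ∀ p → NonWilsonPrime p → 24 ∣ fermatWilsonQuotient p
24∣fermatWilsonQuotient 0 (pp , _) = ⊥-elim (¬prime[0] pp)
24∣fermatWilsonQuotient 1 (pp , _) = ⊥-elim (¬prime[1] pp)
24∣fermatWilsonQuotient 2 _        = divides 0 refl
24∣fermatWilsonQuotient 3 _        = divides 0 refl
24∣fermatWilsonQuotient 4 (pp , _) = ⊥-elim (prime⇒¬composite pp composite[4])
24∣fermatWilsonQuotient (suc (suc r@(suc (suc (suc _))))) nwp = 24∣q-for-p≥5 r (s≤s (s≤s (s≤s z≤n))) nwp

nonWilson-7 : NonWilsonPrime 7
nonWilson-7 = toWitness {a? = prime? 7} _ , toWitnessFalse {a? = 7 ∣? wilsonQuotient 7} _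

nonWilson-11 : NonWilsonPrime 11
nonWilson-11 = toWitness {a? = prime? 11} _ , toWitnessFalse {a? = 11 ∣? wilsonQuotient 11} _

gcd-q₇-q₁₁ : gcd (fermatWilsonQuotient 7) (fermatWilsonQuotient 11) ≡ 24
gcd-q₇-q₁₁ = refl

common-divisor∣24 : ∀ d → (∀ p → NonWilsonPrime p → d ∣ fermatWilsonQuotient p) → d ∣ 24
common-divisor∣24 d d∣q = subst (d ∣_) gcd-q₇-q₁₁ (gcd-greatest (d∣q 7 nonWilson-7) (d∣q 11 nonWilson-11))

theorem2 : ((p : ℕ) → NonWilsonPrime p → 24 ∣ fermatWilsonQuotient p)
           × ((d : ℕ) → ((p : ℕ) → NonWilsonPrime p → d ∣ fermatWilsonQuotient p) → d ∣ 24)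
           × ((p : ℕ) → NonWilsonPrime p → ¬ Prime (fermatWilsonQuotient p))
theorem2 = 24∣fermatWilsonQuotient
         , common-divisor∣24
         , λ p nwp → 24∣⇒¬prime (24∣fermatWilsonQuotient p nwp)
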